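{- For any positive integer $n$, the following identities of rational functions in $q$ hold: $$\sum_{k=0}^{n-1}\frac{(q;q^2)_k}{(q;q)_k}q^k+\frac{1}{1-q}\sum_{k=0}^{n-1}\frac{(q^{ -1};q^2)_k}{(q;q)_k}q^k(1-q^k)=\frac{(q;q^2)_{n-1}}{(q;q)_{n-1}}q^{n-1}$$ and $$\frac{1}{1-q}\sum_{k=0}^{n-1}\frac{(q^{ -1};q^2)_k}{(q;q)_k}q^k(q-q^k)=-\frac{(q;q^2)_{n-1}}{(q;q)_{n-1}}.$$
   Context: The $q$-Pochhammer symbol is defined by $(x;q)_0=1$ and $(x;q)_k=(1-x)(1-xq)\cdots(1-xq^{k-1})$ for $k\ge1$. -}

module Defs where

-- The field of rational functions ℚ(q), realised as the field of fractions
-- of the polynomial ring ℤ[q].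

open import Data.Nat using (ℕ; zero; suc)
open import Data.Integer using (ℤ; +_; -_) renaming (_+_ to _+ℤ_; _*_ to _*ℤ_)
open import Data.List using (List; []; _∷_; map)
open import Data.Product using (_×_)
open import Relation.Nullary using (¬_)
open import Relation.Binary.PropositionalEquality using (_≡_)

-- Polynomials in ℤ[q]: coefficient lists, lowest degree first.

Poly : Set
Poly = List ℤ

infixl 6 _+ₚ_
infixl 7 _*ₚ_

_+ₚ_ : Poly → Poly → Poly
[]       +ₚ ys       = ys
(x ∷ xs) +ₚ []       = x ∷ xs
(x ∷ xs) +ₚ (y ∷ ys) = (x +ℤ y) ∷ (xs +ₚ ys)

scaleₚ : ℤ → Poly → Poly
scaleₚ c p = map (c *ℤ_) p

_*ₚ_ : Poly → Poly → Poly
[]       *ₚ r = []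
(x ∷ xs) *ₚ r = scaleₚ x r +ₚ (+ 0 ∷ (xs *ₚ r))

negₚ : Poly → Poly
negₚ = map -_

coeff : Poly → ℕ → ℤ
coeff []       i       = + 0
coeff (x ∷ xs) zero    = x
coeff (x ∷ xs) (suc i) = coeff xs i

infix 4 _≈ₚ_
_≈ₚ_ : Poly → Poly → Set
p ≈ₚ r = ∀ i → coeff p i ≡ coeff r i

0ₚ : Poly
0ₚ = []

record Frac : Set where
  constructor _/_
  field
    num : Poly
    den : Poly
open Frac public

infix 4 _≈_
_≈_ : Frac → Frac → Set
a ≈ b = (¬ (den a ≈ₚ 0ₚ)) × (¬ (den b ≈ₚ 0ₚ)) × (num a *ₚ den b ≈ₚ num b *ₚ den a)

infixl 6 _+_ _-_
infixl 7 _*_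

_+_ : Frac → Frac → Frac
(a / b) + (c / d) = (a *ₚ d +ₚ c *ₚ b) / (b *ₚ d)

_*_ : Frac → Frac → Frac
(a / b) * (c / d) = (a *ₚ c) / (b *ₚ d)

neg : Frac → Frac
neg (a / b) = negₚ a / b

_-_ : Frac → Frac → Frac
x - y = x + neg y

-- reciprocal (only applied to nonzero rational functions below)
recip : Frac → Frac
recip (a / b) = b / a

_÷_ : Frac → Frac → Frac
x ÷ y = x * recip y

0f 1f q q⁻¹ : Frac
0f  = [] / (+ 1 ∷ [])
1f  = (+ 1 ∷ []) / (+ 1 ∷ [])
q   = (+ 0 ∷ + 1 ∷ []) / (+ 1 ∷ [])
q⁻¹ = (+ 1 ∷ []) / (+ 0 ∷ + 1 ∷ [])

infixr 8 _^_
_^_ : Frac → ℕ → Frac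
x ^ zero  = 1f
x ^ suc k = x ^ k * x

poch : Frac → Frac → ℕ → Frac
poch x y zero    = 1f
poch x y (suc k) = poch x y k * (1f - x * y ^ k)

sumTo : ℕ → (ℕ → Frac) → Frac
sumTo zero    f = 0f
sumTo (suc n) f = sumTo n f + f n

module Submission where

-- Since (q⁻¹;q²)ₖ₊₁ = (1-q⁻¹)(q;q²)ₖ and (q;q)ₖ₊₁ = (q;q)ₖ(1-q^{k+1}),
--   ν·q·βₖ₊₁ = -αₖ/(1-q^{k+1}),
-- whence ν·βₖ₊₁q^{k+1}(1-q^{k+1}) = -αₖqᵏ and ν·βₖ₊₁q^{k+1}(q-q^{k+1}) = αₖ - αₖ₊₁:
-- both sums telescope.

open import Defs
open import Data.Nat using (ℕ; zero; suc; _≤_; _∸_)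
open import Data.Integer using (ℤ; +_; -_) renaming (_+_ to _+ℤ_; _*_ to _*ℤ_)
import Data.Integer.Properties as ℤ
open import Data.Integer.Solver using (module +-*-Solver)
open import Data.List using ([]; _∷_)
open import Data.Maybe using (Maybe; just; nothing)
open import Data.Product using (_×_) renaming (_,_ to _,,_)
open import Data.Sum using (inj₁; inj₂)
open import Data.Empty using (⊥-elim; ⊥-elim-irr)
open import Relation.Nullary using (¬_; yes; no)
open import Relation.Binary.PropositionalEquality using (_≡_; refl; sym; trans; cong; cong₂)
open import Relation.Binary.Structures using (IsEquivalence)
open import Algebra.Bundles using (RawRing; CommutativeRing)
open import Algebra.Structures.Biased using (IsCommutativeMonoidˡ; IsCommutativeSemiringˡ)
open import Algebra.Solver.Ring.AlmostCommutativeRing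
  using (AlmostCommutativeRing; _-Raw-AlmostCommutative⟶_)
import Algebra.Solver.Ring as RingSolver
import Relation.Binary.Reasoning.Setoid as SetoidReasoning

module ℤS = +-*-Solver

ℤ-rawRing : RawRing _ _
ℤ-rawRing = CommutativeRing.rawRing ℤ.+-*-commutativeRing

-- The polynomial ring ℤ[q]

-- Coefficientwise equality, wrapped in a record so that Agda can infer
-- the two polynomials from an equality proof.
infix 4 _≋_
record _≋_ (p r : Poly) : Set where
  constructor mk
  field get : p ≈ₚ r
open _≋_

≋-refl : ∀ {p} → p ≋ p
≋-refl = mk λ i → refl

≋-sym : ∀ {p r} → p ≋ r → r ≋ p
≋-sym (mk e) = mk λ i → sym (e i)

≋-trans : ∀ {p r s} → p ≋ r → r ≋ s → p ≋ s
≋-trans (mk e) (mk f) = mk λ i → trans (e i) (f i)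

≋-isEquivalence : IsEquivalence _≋_
≋-isEquivalence = record { refl = ≋-refl ; sym = ≋-sym ; trans = ≋-trans }

const-0≋[] : (+ 0 ∷ []) ≋ []
const-0≋[] = mk λ { zero → refl ; (suc i) → refl }

∷-cong : ∀ {x y xs ys} → x ≡ y → xs ≋ ys → (x ∷ xs) ≋ (y ∷ ys)
∷-cong e (mk f) = mk λ { zero → e ; (suc i) → f i }

shift : Poly → Poly
shift p = + 0 ∷ p

coeff-+ : ∀ p r i → coeff (p +ₚ r) i ≡ coeff p i +ℤ coeff r i
coeff-+ []       r        i       = sym (ℤ.+-identityˡ _)
coeff-+ (x ∷ xs) []       i       = sym (ℤ.+-identityʳ _)
coeff-+ (x ∷ xs) (y ∷ ys) zero    = refl
coeff-+ (x ∷ xs) (y ∷ ys) (suc i) = coeff-+ xs ys i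

coeff-scale : ∀ c p i → coeff (scaleₚ c p) i ≡ c *ℤ coeff p i
coeff-scale c []      i       = sym (ℤ.*-zeroʳ c)
coeff-scale c (x ∷ p) zero    = refl
coeff-scale c (x ∷ p) (suc i) = coeff-scale c p i

coeff-neg : ∀ p i → coeff (negₚ p) i ≡ - coeff p i
coeff-neg []      i       = refl
coeff-neg (x ∷ p) zero    = refl
coeff-neg (x ∷ p) (suc i) = coeff-neg p i

coeff-∷* : ∀ x xs r i → coeff ((x ∷ xs) *ₚ r) i ≡ x *ℤ coeff r i +ℤ coeff (shift (xs *ₚ r)) i
coeff-∷* x xs r i = trans (coeff-+ (scaleₚ x r) (shift (xs *ₚ r)) i)
  (cong (_+ℤ coeff (shift (xs *ₚ r)) i) (coeff-scale x r i))

coeff-shift* : ∀ xs r i → coeff (shift xs *ₚ r) i ≡ coeff (shift (xs *ₚ r)) i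
coeff-shift* xs r i = trans (coeff-∷* (+ 0) xs r i)
  (ℤS.solve 2 (λ a s → ℤS.con (+ 0) ℤS.:* a ℤS.:+ s ℤS.:= s) refl (coeff r i) _)

+ₚ-cong : ∀ {p p' r r'} → p ≋ p' → r ≋ r' → (p +ₚ r) ≋ (p' +ₚ r')
+ₚ-cong {p} {p'} {r} {r'} (mk e) (mk f) = mk λ i →
  trans (coeff-+ p r i) (trans (cong₂ _+ℤ_ (e i) (f i)) (sym (coeff-+ p' r' i)))

negₚ-cong : ∀ {p r} → p ≋ r → negₚ p ≋ negₚ r
negₚ-cong {p} {r} (mk e) = mk λ i → trans (coeff-neg p i) (trans (cong -_ (e i)) (sym (coeff-neg r i)))

*ₚ-congʳ : ∀ p {r r'} → r ≋ r' → (p *ₚ r) ≋ (p *ₚ r')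
*ₚ-congʳ []       e = ≋-refl
*ₚ-congʳ (x ∷ xs) {r} {r'} (mk e) = mk λ i → trans (coeff-∷* x xs r i)
  (trans (cong₂ _+ℤ_ (cong (x *ℤ_) (e i)) (get (∷-cong refl (*ₚ-congʳ xs (mk e))) i))
         (sym (coeff-∷* x xs r' i)))

*ₚ-zeroˡ : ∀ p r → [] ≋ p → (p *ₚ r) ≋ []
*ₚ-zeroˡ []       r e      = ≋-refl
*ₚ-zeroˡ (x ∷ xs) r (mk e) = mk λ i → trans (coeff-∷* x xs r i)
  (trans (cong₂ _+ℤ_ (cong (_*ℤ coeff r i) (sym (e zero)))
                     (get (∷-cong refl (*ₚ-zeroˡ xs r (mk λ j → e (suc j)))) i))
  (trans (cong (_+ℤ coeff (shift []) i) (ℤ.*-zeroˡ (coeff r i))) (shift-[] i)))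
  where
  shift-[] : ∀ i → + 0 +ℤ coeff (shift []) i ≡ coeff [] i
  shift-[] zero    = refl
  shift-[] (suc i) = refl

*ₚ-congˡ : ∀ {p p'} r → p ≋ p' → (p *ₚ r) ≋ (p' *ₚ r)
*ₚ-congˡ {[]}     {p'}     r e = ≋-sym (*ₚ-zeroˡ p' r e)
*ₚ-congˡ {x ∷ xs} {[]}     r e = *ₚ-zeroˡ (x ∷ xs) r (≋-sym e)
*ₚ-congˡ {x ∷ xs} {y ∷ ys} r (mk e) = mk λ i → trans (coeff-∷* x xs r i)
  (trans (cong₂ _+ℤ_ (cong (_*ℤ coeff r i) (e zero))
                     (get (∷-cong refl (*ₚ-congˡ {xs} {ys} r (mk λ j → e (suc j)))) i))
         (sym (coeff-∷* y ys r i)))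

*ₚ-cong : ∀ {p p' r r'} → p ≋ p' → r ≋ r' → (p *ₚ r) ≋ (p' *ₚ r')
*ₚ-cong {p' = p'} {r = r} e f = ≋-trans (*ₚ-congˡ r e) (*ₚ-congʳ p' f)

+ₚ-assoc : ∀ p r s → ((p +ₚ r) +ₚ s) ≋ (p +ₚ (r +ₚ s))
+ₚ-assoc p r s = mk λ i →
  trans (coeff-+ (p +ₚ r) s i) (trans (cong (_+ℤ coeff s i) (coeff-+ p r i))
  (trans (ℤ.+-assoc (coeff p i) (coeff r i) (coeff s i))
  (trans (cong (coeff p i +ℤ_) (sym (coeff-+ r s i))) (sym (coeff-+ p (r +ₚ s) i)))))

+ₚ-comm : ∀ p r → (p +ₚ r) ≋ (r +ₚ p)
+ₚ-comm p r = mk λ i →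
  trans (coeff-+ p r i) (trans (ℤ.+-comm (coeff p i) (coeff r i)) (sym (coeff-+ r p i)))

+ₚ-identityʳ : ∀ p → (p +ₚ []) ≋ p
+ₚ-identityʳ p = mk λ i → trans (coeff-+ p [] i) (ℤ.+-identityʳ _)

negₚ-+-comm : ∀ p r → (negₚ p +ₚ negₚ r) ≋ negₚ (p +ₚ r)
negₚ-+-comm p r = mk λ i →
  trans (coeff-+ (negₚ p) (negₚ r) i)
  (trans (cong₂ _+ℤ_ (coeff-neg p i) (coeff-neg r i))
  (trans (sym (ℤ.neg-distrib-+ (coeff p i) (coeff r i)))
  (trans (cong -_ (sym (coeff-+ p r i))) (sym (coeff-neg (p +ₚ r) i)))))

*ₚ-zeroʳ : ∀ p → (p *ₚ []) ≋ []
*ₚ-zeroʳ []       = ≋-refl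
*ₚ-zeroʳ (x ∷ xs) = mk λ { zero → refl ; (suc i) → get (*ₚ-zeroʳ xs) i }

*ₚ-distribʳ : ∀ p p' r → ((p +ₚ p') *ₚ r) ≋ ((p *ₚ r) +ₚ (p' *ₚ r))
*ₚ-distribʳ []       p'       r = ≋-refl
*ₚ-distribʳ (x ∷ xs) []       r = ≋-sym (+ₚ-identityʳ _)
*ₚ-distribʳ (x ∷ xs) (y ∷ ys) r = mk λ i →
  trans (coeff-∷* (x +ℤ y) (xs +ₚ ys) r i)
  (trans (cong ((x +ℤ y) *ℤ coeff r i +ℤ_)
               (trans (get (∷-cong refl (*ₚ-distribʳ xs ys r)) i)
                      (coeff-+ (shift (xs *ₚ r)) (shift (ys *ₚ r)) i)))
  (trans (interchange x y (coeff r i) _ _)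
  (sym (trans (coeff-+ ((x ∷ xs) *ₚ r) ((y ∷ ys) *ₚ r) i)
              (cong₂ _+ℤ_ (coeff-∷* x xs r i) (coeff-∷* y ys r i))))))
  where
  open ℤS
  interchange : ∀ x y a c d → (x +ℤ y) *ℤ a +ℤ (c +ℤ d) ≡ (x *ℤ a +ℤ c) +ℤ (y *ℤ a +ℤ d)
  interchange = solve 5 (λ x y a c d → (x :+ y) :* a :+ (c :+ d) := (x :* a :+ c) :+ (y :* a :+ d)) refl

*ₚ-∷ : ∀ p y ys → (p *ₚ (y ∷ ys)) ≋ (scaleₚ y p +ₚ shift (p *ₚ ys))
*ₚ-∷ []       y ys = mk λ { zero → refl ; (suc i) → refl }
*ₚ-∷ (x ∷ xs) y ys = mk λ
  { zero → trans (coeff-∷* x xs (y ∷ ys) zero)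
      (trans (ℤS.solve 2 (λ x y → x ℤS.:* y ℤS.:+ ℤS.con (+ 0) ℤS.:= y ℤS.:* x ℤS.:+ ℤS.con (+ 0)) refl x y)
      (sym (trans (coeff-+ (scaleₚ y (x ∷ xs)) (shift ((x ∷ xs) *ₚ ys)) zero)
                  (cong (_+ℤ + 0) (coeff-scale y (x ∷ xs) zero)))))
  ; (suc j) → trans (coeff-∷* x xs (y ∷ ys) (suc j))
      (trans (cong (x *ℤ coeff ys j +ℤ_)
                   (trans (get (*ₚ-∷ xs y ys) j)
                   (trans (coeff-+ (scaleₚ y xs) (shift (xs *ₚ ys)) j)
                          (cong (_+ℤ coeff (shift (xs *ₚ ys)) j) (coeff-scale y xs j)))))
      (trans (ℤS.solve 4 (λ x a b s → x ℤS.:* a ℤS.:+ (b ℤS.:+ s) ℤS.:= b ℤS.:+ (x ℤS.:* a ℤS.:+ s))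
                refl x (coeff ys j) (y *ℤ coeff xs j) (coeff (shift (xs *ₚ ys)) j))
      (sym (trans (coeff-+ (scaleₚ y (x ∷ xs)) (shift ((x ∷ xs) *ₚ ys)) (suc j))
                  (cong₂ _+ℤ_ (coeff-scale y xs j) (coeff-∷* x xs ys j))))))
  }

*ₚ-comm : ∀ p r → (p *ₚ r) ≋ (r *ₚ p)
*ₚ-comm []       r = ≋-sym (*ₚ-zeroʳ r)
*ₚ-comm (x ∷ xs) r = ≋-trans (+ₚ-cong ≋-refl (∷-cong refl (*ₚ-comm xs r))) (≋-sym (*ₚ-∷ r x xs))

scaleₚ-*ₚ : ∀ c r s → (scaleₚ c r *ₚ s) ≋ scaleₚ c (r *ₚ s)
scaleₚ-*ₚ c []       s = ≋-refl
scaleₚ-*ₚ c (y ∷ ys) s = mk λ i →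
  trans (coeff-∷* (c *ℤ y) (scaleₚ c ys) s i)
  (trans (cong ((c *ℤ y) *ℤ coeff s i +ℤ_) (trans (get (∷-cong refl (scaleₚ-*ₚ c ys s)) i) (scale-shift i)))
  (trans (ℤS.solve 4 (λ c y a s → (c ℤS.:* y) ℤS.:* a ℤS.:+ c ℤS.:* s ℤS.:= c ℤS.:* (y ℤS.:* a ℤS.:+ s))
            refl c y (coeff s i) (coeff (shift (ys *ₚ s)) i))
  (sym (trans (coeff-scale c ((y ∷ ys) *ₚ s) i) (cong (c *ℤ_) (coeff-∷* y ys s i))))))
  where
  scale-shift : ∀ i → coeff (shift (scaleₚ c (ys *ₚ s))) i ≡ c *ℤ coeff (shift (ys *ₚ s)) i
  scale-shift zero    = sym (ℤ.*-zeroʳ c)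
  scale-shift (suc i) = coeff-scale c (ys *ₚ s) i

*ₚ-assoc : ∀ p r s → ((p *ₚ r) *ₚ s) ≋ (p *ₚ (r *ₚ s))
*ₚ-assoc []       r s = ≋-refl
*ₚ-assoc (x ∷ xs) r s =
  ≋-trans (*ₚ-distribʳ (scaleₚ x r) (shift (xs *ₚ r)) s)
  (+ₚ-cong (scaleₚ-*ₚ x r s)
           (≋-trans (mk (coeff-shift* (xs *ₚ r) s)) (∷-cong refl (*ₚ-assoc xs r s))))

*ₚ-identityˡ : ∀ r → ((+ 1 ∷ []) *ₚ r) ≋ r
*ₚ-identityˡ r = mk λ i → trans (coeff-∷* (+ 1) [] r i) (unit i)
  where
  unit : ∀ i → + 1 *ℤ coeff r i +ℤ coeff (shift []) i ≡ coeff r i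
  unit zero    = ℤS.solve 1 (λ a → ℤS.con (+ 1) ℤS.:* a ℤS.:+ ℤS.con (+ 0) ℤS.:= a) refl _
  unit (suc i) = ℤS.solve 1 (λ a → ℤS.con (+ 1) ℤS.:* a ℤS.:+ ℤS.con (+ 0) ℤS.:= a) refl _

negₚ-*-distribˡ : ∀ p r → (negₚ p *ₚ r) ≋ negₚ (p *ₚ r)
negₚ-*-distribˡ []       r = ≋-refl
negₚ-*-distribˡ (x ∷ xs) r = mk λ i →
  trans (coeff-∷* (- x) (negₚ xs) r i)
  (trans (cong ((- x) *ℤ coeff r i +ℤ_) (trans (get (∷-cong refl (negₚ-*-distribˡ xs r)) i) (neg-shift i)))
  (trans (ℤS.solve 3 (λ x a s → (ℤS.:- x) ℤS.:* a ℤS.:+ (ℤS.:- s) ℤS.:= ℤS.:- (x ℤS.:* a ℤS.:+ s)) refl x (coeff r i) _)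
  (sym (trans (coeff-neg ((x ∷ xs) *ₚ r) i) (cong -_ (coeff-∷* x xs r i))))))
  where
  neg-shift : ∀ i → coeff (shift (negₚ (xs *ₚ r))) i ≡ - coeff (shift (xs *ₚ r)) i
  neg-shift zero    = refl
  neg-shift (suc i) = coeff-neg (xs *ₚ r) i

PolyRing : AlmostCommutativeRing _ _
PolyRing = record
  { Carrier = Poly ; _≈_ = _≋_ ; _+_ = _+ₚ_ ; _*_ = _*ₚ_ ; -_ = negₚ ; 0# = [] ; 1# = + 1 ∷ []
  ; isAlmostCommutativeRing = record
    { isCommutativeSemiring = IsCommutativeSemiringˡ.isCommutativeSemiring (record
        { +-isCommutativeMonoid = IsCommutativeMonoidˡ.isCommutativeMonoid (record
            { isSemigroup = record
                { isMagma = record { isEquivalence = ≋-isEquivalence ; ∙-cong = +ₚ-cong }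
                ; assoc = +ₚ-assoc }
            ; identityˡ = λ p → ≋-refl ; comm = +ₚ-comm })
        ; *-isCommutativeMonoid = IsCommutativeMonoidˡ.isCommutativeMonoid (record
            { isSemigroup = record
                { isMagma = record { isEquivalence = ≋-isEquivalence ; ∙-cong = *ₚ-cong }
                ; assoc = *ₚ-assoc }
            ; identityˡ = *ₚ-identityˡ ; comm = *ₚ-comm })
        ; distribʳ = λ r p p' → *ₚ-distribʳ p p' r
        ; zeroˡ = λ r → ≋-refl })
    ; -‿cong = negₚ-cong
    ; -‿*-distribˡ = negₚ-*-distribˡ
    ; -‿+-comm = negₚ-+-comm
    }
  }

ℤ⟶Poly : ℤ-rawRing -Raw-AlmostCommutative⟶ PolyRing
ℤ⟶Poly = record
  { ⟦_⟧    = λ c → c ∷ []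
  ; +-homo = λ x y → ≋-refl
  ; *-homo = λ x y → mk λ { zero → sym (ℤ.+-identityʳ _) ; (suc i) → refl }
  ; -‿homo = λ x → ≋-refl
  ; 0-homo = const-0≋[]
  ; 1-homo = ≋-refl
  }

constₚ-equal? : ∀ a b → Maybe ((a ∷ []) ≋ (b ∷ []))
constₚ-equal? a b with a ℤ.≟ b
... | yes refl = just ≋-refl
... | no _     = nothing

module PolySolver = RingSolver ℤ-rawRing PolyRing ℤ⟶Poly constₚ-equal?

NonZeroₚ : Poly → Set
NonZeroₚ p = ¬ (p ≋ [])

-- If d ≠ 0 and d·r = 0 then r = 0: strip the zero low-order coefficients
-- of d; once d has a nonzero constant term c, the lowest coefficient s of r
-- satisfies c·s = 0, so s = 0, and induction on r finishes.
*ₚ-zero-divisor-free : ∀ d r → .(NonZeroₚ d) → (d *ₚ r) ≋ [] → r ≋ []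
*ₚ-zero-divisor-free [] r d≠0 e = ⊥-elim-irr (d≠0 ≋-refl)
*ₚ-zero-divisor-free (c ∷ d') r d≠0 e with c ℤ.≟ + 0
... | yes refl = *ₚ-zero-divisor-free d' r (λ z → d≠0 (mk λ { zero → refl ; (suc i) → get z i }))
                    (mk λ i → trans (sym (coeff-shift* d' r (suc i))) (get e (suc i)))
... | no c≢0 = kill r e
  where
  kill : ∀ r → ((c ∷ d') *ₚ r) ≋ [] → r ≋ []
  kill []       e = ≋-refl
  kill (s ∷ r') e = mk λ { zero → s≡0 ; (suc i) → get (kill r' tail≡0) i }
    where
    c*s≡0 : c *ℤ s ≡ + 0
    c*s≡0 = trans (sym (ℤ.+-identityʳ _)) (trans (sym (coeff-∷* c d' (s ∷ r') zero)) (get e zero))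
    s≡0 : s ≡ + 0
    s≡0 with ℤ.i*j≡0⇒i≡0∨j≡0 c c*s≡0
    ... | inj₁ c≡0 = ⊥-elim (c≢0 c≡0)
    ... | inj₂ s≡0 = s≡0
    tail≡0 : ((c ∷ d') *ₚ r') ≋ []
    tail≡0 = mk λ i → trans (sym (trans (coeff-+ (scaleₚ s (c ∷ d')) (shift ((c ∷ d') *ₚ r')) (suc i))
                 (trans (cong (_+ℤ coeff ((c ∷ d') *ₚ r') i)
                              (trans (coeff-scale s d' i) (cong (_*ℤ coeff d' i) s≡0)))
                        (ℤ.+-identityˡ _))))
               (trans (sym (get (*ₚ-∷ (c ∷ d') s r') (suc i))) (get e (suc i)))

*ₚ-nonZero : ∀ {a b} → .(NonZeroₚ a) → .(NonZeroₚ b) → NonZeroₚ (a *ₚ b)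
*ₚ-nonZero {a} {b} a≠0 b≠0 e = ⊥-elim-irr (b≠0 (*ₚ-zero-divisor-free a b a≠0 e))

-- Nonzero polynomials are cancellable: d·a = d·b gives d·(a - b) = 0.
*ₚ-cancelˡ : ∀ d {a b} → .(NonZeroₚ d) → (d *ₚ a) ≋ (d *ₚ b) → a ≋ b
*ₚ-cancelˡ d {a} {b} d≠0 e = ≋-trans (split a b) (+ₚ-cong a-b≋0 ≋-refl)
  where
  open PolySolver
  split : ∀ a b → a ≋ ((a +ₚ negₚ b) +ₚ b)
  split = solve 2 (λ a b → a := (a :+ :- b) :+ b) ≋-refl
  distrib : ∀ d a b → (d *ₚ (a +ₚ negₚ b)) ≋ (d *ₚ a +ₚ negₚ (d *ₚ b))
  distrib = solve 3 (λ d a b → d :* (a :+ :- b) := d :* a :+ :- (d :* b)) ≋-refl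
  sub-self : ∀ x → (x +ₚ negₚ x) ≋ []
  sub-self x = ≋-trans (solve 1 (λ x → x :+ :- x := con (+ 0)) ≋-refl x) const-0≋[]
  a-b≋0 : (a +ₚ negₚ b) ≋ []
  a-b≋0 = *ₚ-zero-divisor-free d _ d≠0
    (≋-trans (distrib d a b) (≋-trans (+ₚ-cong e ≋-refl) (sub-self (d *ₚ b))))

-- The field of fractions ℚ(q)

-- A fraction together with (an irrelevant proof) that its denominator is
-- nonzero: exactly the fractions on which Defs._≈_ can hold.
infixr 4 _,_
record RatF : Set where
  constructor _,_
  field
    frac   : Frac
    .den≠0 : NonZeroₚ (den frac)
open RatF

one≠0 : NonZeroₚ (+ 1 ∷ [])
one≠0 e with get e zero
... | ()

-- Being a negation, nonvanishing can be recovered from an irrelevant proof.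
nonZero-relevant : ∀ {p} → .(NonZeroₚ p) → NonZeroₚ p
nonZero-relevant p≠0 e = ⊥-elim-irr (p≠0 e)

den-nonZero : (x : RatF) → NonZeroₚ (den (frac x))
den-nonZero (_ , x≠0) = nonZero-relevant x≠0

-- Cross-multiplication equality, i.e. Defs._≈_ without the (now automatic)
-- side conditions on the denominators.
infix 4 _≈ᶠ_
record _≈ᶠ_ (x y : RatF) : Set where
  constructor mkᶠ
  field cross : (num (frac x) *ₚ den (frac y)) ≋ (num (frac y) *ₚ den (frac x))

≈ᶠ⇒≈ : ∀ {x y} → x ≈ᶠ y → frac x ≈ frac y
≈ᶠ⇒≈ {x} {y} (mkᶠ e) = (λ z → den-nonZero x (mk z)) ,, (λ z → den-nonZero y (mk z)) ,, get e

infixl 6 _+ᶠ_ _-ᶠ_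
infixl 7 _*ᶠ_
infixr 8 _^ᶠ_

_+ᶠ_ : RatF → RatF → RatF
(x , x≠0) +ᶠ (y , y≠0) = x + y , *ₚ-nonZero x≠0 y≠0

_*ᶠ_ : RatF → RatF → RatF
(x , x≠0) *ᶠ (y , y≠0) = x * y , *ₚ-nonZero x≠0 y≠0

-ᶠ_ : RatF → RatF
-ᶠ (x , x≠0) = neg x , x≠0

_-ᶠ_ : RatF → RatF → RatF
x -ᶠ y = x +ᶠ -ᶠ y

0ᶠ 1ᶠ : RatF
0ᶠ = 0f , one≠0
1ᶠ = 1f , one≠0

recipᶠ : (x : RatF) → .(NonZeroₚ (num (frac x))) → RatF
recipᶠ (x , _) num≠0 = recip x , num≠0

module _ where
  private
    nx dx : RatF → Poly
    nx x = num (frac x)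
    dx x = den (frac x)

  ≈ᶠ-refl : ∀ {x} → x ≈ᶠ x
  ≈ᶠ-refl = mkᶠ ≋-refl

  ≈ᶠ-sym : ∀ {x y} → x ≈ᶠ y → y ≈ᶠ x
  ≈ᶠ-sym (mkᶠ e) = mkᶠ (≋-sym e)

  -- Transitivity is where the denominators must be nonzero: from
  -- a·d_y = b·d_x and b·d_z = c·d_y we get d_y·(a·d_z) = d_y·(c·d_x)
  -- and cancel d_y.
  ≈ᶠ-trans : ∀ {x y z} → x ≈ᶠ y → y ≈ᶠ z → x ≈ᶠ z
  ≈ᶠ-trans {x} {y@(_ , y≠0)} {z} (mkᶠ e) (mkᶠ f) = mkᶠ (*ₚ-cancelˡ (dx y) y≠0
    (≋-trans (reassoc₁ (dx y) (nx x) (dx z))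
    (≋-trans (*ₚ-congˡ (dx z) e)
    (≋-trans (reassoc₂ (nx y) (dx x) (dx z))
    (≋-trans (*ₚ-congˡ (dx x) f) (reassoc₃ (nx z) (dx y) (dx x)))))))
    where
    open PolySolver
    reassoc₁ : ∀ d a c → (d *ₚ (a *ₚ c)) ≋ ((a *ₚ d) *ₚ c)
    reassoc₁ = solve 3 (λ d a c → d :* (a :* c) := (a :* d) :* c) ≋-refl
    reassoc₂ : ∀ b e c → ((b *ₚ e) *ₚ c) ≋ ((b *ₚ c) *ₚ e)
    reassoc₂ = solve 3 (λ b e c → (b :* e) :* c := (b :* c) :* e) ≋-refl
    reassoc₃ : ∀ c d e → ((c *ₚ d) *ₚ e) ≋ (d *ₚ (c *ₚ e))
    reassoc₃ = solve 3 (λ c d e → (c :* d) :* e := d :* (c :* e)) ≋-refl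

  ≈ᶠ-isEquivalence : IsEquivalence _≈ᶠ_
  ≈ᶠ-isEquivalence = record { refl = ≈ᶠ-refl ; sym = ≈ᶠ-sym ; trans = ≈ᶠ-trans }

  -- Each ring law for fractions is a polynomial identity between
  -- numerators and denominators.
  +ᶠ-cong : ∀ {x x' y y'} → x ≈ᶠ x' → y ≈ᶠ y' → (x +ᶠ y) ≈ᶠ (x' +ᶠ y')
  +ᶠ-cong {x} {x'} {y} {y'} (mkᶠ e) (mkᶠ f) = mkᶠ
    (≋-trans (expand (nx x) (dx x) (nx y) (dx y) (dx x') (dx y'))
    (≋-trans (+ₚ-cong (*ₚ-congˡ (dx y *ₚ dx y') e) (*ₚ-congˡ (dx x *ₚ dx x') f))
             (collect (dx x) (dx y) (nx x') (dx x') (nx y') (dx y'))))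
    where
    open PolySolver
    expand : ∀ a b c d b' d' → ((a *ₚ d +ₚ c *ₚ b) *ₚ (b' *ₚ d')) ≋ ((a *ₚ b') *ₚ (d *ₚ d') +ₚ (c *ₚ d') *ₚ (b *ₚ b'))
    expand = solve 6 (λ a b c d b' d' → (a :* d :+ c :* b) :* (b' :* d') := (a :* b') :* (d :* d') :+ (c :* d') :* (b :* b')) ≋-refl
    collect : ∀ b d a' b' c' d' → ((a' *ₚ b) *ₚ (d *ₚ d') +ₚ (c' *ₚ d) *ₚ (b *ₚ b')) ≋ ((a' *ₚ d' +ₚ c' *ₚ b') *ₚ (b *ₚ d))
    collect = solve 6 (λ b d a' b' c' d' → (a' :* b) :* (d :* d') :+ (c' :* d) :* (b :* b') := (a' :* d' :+ c' :* b') :* (b :* d)) ≋-refl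

  *ᶠ-cong : ∀ {x x' y y'} → x ≈ᶠ x' → y ≈ᶠ y' → (x *ᶠ y) ≈ᶠ (x' *ᶠ y')
  *ᶠ-cong {x} {x'} {y} {y'} (mkᶠ e) (mkᶠ f) = mkᶠ
    (≋-trans (interchange (nx x) (dx x') (nx y) (dx y'))
    (≋-trans (*ₚ-cong e f) (interchange (nx x') (nx y') (dx x) (dx y))))
    where
    open PolySolver
    interchange : ∀ a b c d → ((a *ₚ c) *ₚ (b *ₚ d)) ≋ ((a *ₚ b) *ₚ (c *ₚ d))
    interchange = solve 4 (λ a b c d → (a :* c) :* (b :* d) := (a :* b) :* (c :* d)) ≋-refl

  -ᶠ-cong : ∀ {x y} → x ≈ᶠ y → (-ᶠ x) ≈ᶠ (-ᶠ y)
  -ᶠ-cong {x} {y} (mkᶠ e) = mkᶠ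
    (≋-trans (negₚ-*-distribˡ (nx x) (dx y)) (≋-trans (negₚ-cong e) (≋-sym (negₚ-*-distribˡ (nx y) (dx x)))))

  open PolySolver using (solve; _:=_; _:+_; _:*_; :-_; con)

  +ᶠ-assoc : ∀ x y z → ((x +ᶠ y) +ᶠ z) ≈ᶠ (x +ᶠ (y +ᶠ z))
  +ᶠ-assoc x y z = mkᶠ (solve 6 (λ a b c d e f →
      (((a :* d :+ c :* b) :* f) :+ e :* (b :* d)) :* (b :* (d :* f))
    := (a :* (d :* f) :+ (c :* f :+ e :* d) :* b) :* ((b :* d) :* f)) ≋-refl
    (nx x) (dx x) (nx y) (dx y) (nx z) (dx z))

  +ᶠ-comm : ∀ x y → (x +ᶠ y) ≈ᶠ (y +ᶠ x)
  +ᶠ-comm x y = mkᶠ (solve 4 (λ a b c d →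
      (a :* d :+ c :* b) :* (d :* b) := (c :* b :+ a :* d) :* (b :* d)) ≋-refl
    (nx x) (dx x) (nx y) (dx y))

  +ᶠ-identityˡ : ∀ x → (0ᶠ +ᶠ x) ≈ᶠ x
  +ᶠ-identityˡ x = mkᶠ (solve 2 (λ a b → (a :* con (+ 1)) :* b := a :* (con (+ 1) :* b)) ≋-refl
    (nx x) (dx x))

  *ᶠ-assoc : ∀ x y z → ((x *ᶠ y) *ᶠ z) ≈ᶠ (x *ᶠ (y *ᶠ z))
  *ᶠ-assoc x y z = mkᶠ (solve 6 (λ a b c d e f →
      ((a :* c) :* e) :* (b :* (d :* f)) := (a :* (c :* e)) :* ((b :* d) :* f)) ≋-refl
    (nx x) (dx x) (nx y) (dx y) (nx z) (dx z))

  *ᶠ-comm : ∀ x y → (x *ᶠ y) ≈ᶠ (y *ᶠ x)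
  *ᶠ-comm x y = mkᶠ (solve 4 (λ a b c d → (a :* c) :* (d :* b) := (c :* a) :* (b :* d)) ≋-refl
    (nx x) (dx x) (nx y) (dx y))

  *ᶠ-identityˡ : ∀ x → (1ᶠ *ᶠ x) ≈ᶠ x
  *ᶠ-identityˡ x = mkᶠ (solve 2 (λ a b → (con (+ 1) :* a) :* b := a :* (con (+ 1) :* b)) ≋-refl
    (nx x) (dx x))

  *ᶠ-distribʳ : ∀ x y z → ((y +ᶠ z) *ᶠ x) ≈ᶠ ((y *ᶠ x) +ᶠ (z *ᶠ x))
  *ᶠ-distribʳ x y z = mkᶠ (solve 6 (λ a b c d e f →
      ((c :* f :+ e :* d) :* a) :* ((d :* b) :* (f :* b))
    := ((c :* a) :* (f :* b) :+ (e :* a) :* (d :* b)) :* ((d :* f) :* b)) ≋-refl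
    (nx x) (dx x) (nx y) (dx y) (nx z) (dx z))

  -ᶠ-*-distribˡ : ∀ x y → ((-ᶠ x) *ᶠ y) ≈ᶠ (-ᶠ (x *ᶠ y))
  -ᶠ-*-distribˡ x y = mkᶠ (solve 4 (λ a b c d →
      ((:- a) :* c) :* (b :* d) := (:- (a :* c)) :* (b :* d)) ≋-refl
    (nx x) (dx x) (nx y) (dx y))

  -ᶠ-+-comm : ∀ x y → ((-ᶠ x) +ᶠ (-ᶠ y)) ≈ᶠ (-ᶠ (x +ᶠ y))
  -ᶠ-+-comm x y = mkᶠ (solve 4 (λ a b c d →
      ((:- a) :* d :+ (:- c) :* b) :* (b :* d) := (:- (a :* d :+ c :* b)) :* (b :* d)) ≋-refl
    (nx x) (dx x) (nx y) (dx y))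

  recipᶠ-inverseˡ : ∀ x .(num≠0 : NonZeroₚ (num (frac x))) → (recipᶠ x num≠0 *ᶠ x) ≈ᶠ 1ᶠ
  recipᶠ-inverseˡ x _ = mkᶠ (solve 2 (λ a b → (b :* a) :* con (+ 1) := con (+ 1) :* (a :* b)) ≋-refl
    (nx x) (dx x))

RatRing : AlmostCommutativeRing _ _
RatRing = record
  { Carrier = RatF ; _≈_ = _≈ᶠ_ ; _+_ = _+ᶠ_ ; _*_ = _*ᶠ_ ; -_ = -ᶠ_ ; 0# = 0ᶠ ; 1# = 1ᶠ
  ; isAlmostCommutativeRing = record
    { isCommutativeSemiring = IsCommutativeSemiringˡ.isCommutativeSemiring (record
        { +-isCommutativeMonoid = IsCommutativeMonoidˡ.isCommutativeMonoid (record
            { isSemigroup = record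
                { isMagma = record { isEquivalence = ≈ᶠ-isEquivalence ; ∙-cong = +ᶠ-cong }
                ; assoc = +ᶠ-assoc }
            ; identityˡ = +ᶠ-identityˡ ; comm = +ᶠ-comm })
        ; *-isCommutativeMonoid = IsCommutativeMonoidˡ.isCommutativeMonoid (record
            { isSemigroup = record
                { isMagma = record { isEquivalence = ≈ᶠ-isEquivalence ; ∙-cong = *ᶠ-cong }
                ; assoc = *ᶠ-assoc }
            ; identityˡ = *ᶠ-identityˡ ; comm = *ᶠ-comm })
        ; distribʳ = *ᶠ-distribʳ
        ; zeroˡ = λ x → mkᶠ ≋-refl })
    ; -‿cong = -ᶠ-cong
    ; -‿*-distribˡ = -ᶠ-*-distribˡ
    ; -‿+-comm = -ᶠ-+-comm
    }
  }

constᶠ : ℤ → RatF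
constᶠ c = (c ∷ []) / (+ 1 ∷ []) , one≠0

ℤ⟶RatF : ℤ-rawRing -Raw-AlmostCommutative⟶ RatRing
ℤ⟶RatF = record
  { ⟦_⟧    = constᶠ
  ; +-homo = λ a b → mkᶠ (solve 2 (λ a b → (a :+ b) :* (one :* one) := (a :* one :+ b :* one) :* one)
                           ≋-refl (a ∷ []) (b ∷ []))
  ; *-homo = λ a b → mkᶠ (≋-trans (*ₚ-congˡ ((+ 1 ∷ []) *ₚ (+ 1 ∷ [])) (*-homo a b))
                           (solve 2 (λ a b → (a :* b) :* (one :* one) := (a :* b) :* one) ≋-refl (a ∷ []) (b ∷ [])))
  ; -‿homo = λ a → ≈ᶠ-refl
  ; 0-homo = mkᶠ (mk λ { zero → refl ; (suc i) → refl })
  ; 1-homo = ≈ᶠ-refl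
  }
  where
  open PolySolver using (solve; _:=_; _:+_; _:*_; con; Polynomial)
  open _-Raw-AlmostCommutative⟶_ ℤ⟶Poly using (*-homo)
  one : ∀ {n} → Polynomial n
  one = con (+ 1)

constᶠ-equal? : ∀ a b → Maybe (constᶠ a ≈ᶠ constᶠ b)
constᶠ-equal? a b with a ℤ.≟ b
... | yes refl = just ≈ᶠ-refl
... | no _     = nothing

module RatSolver = RingSolver ℤ-rawRing RatRing ℤ⟶RatF constᶠ-equal?
open SetoidReasoning (AlmostCommutativeRing.setoid RatRing)

*ᶠ-congʳ : ∀ {x x'} → x ≈ᶠ x' → ∀ y → (x *ᶠ y) ≈ᶠ (x' *ᶠ y)
*ᶠ-congʳ e y = *ᶠ-cong e (≈ᶠ-refl {y})

*ᶠ-congˡ : ∀ y {x x'} → x ≈ᶠ x' → (y *ᶠ x) ≈ᶠ (y *ᶠ x')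
*ᶠ-congˡ y e = *ᶠ-cong (≈ᶠ-refl {y}) e

+ᶠ-congˡ : ∀ y {x x'} → x ≈ᶠ x' → (y +ᶠ x) ≈ᶠ (y +ᶠ x')
+ᶠ-congˡ y e = +ᶠ-cong (≈ᶠ-refl {y}) e

+ᶠ-congʳ : ∀ {x x'} → x ≈ᶠ x' → ∀ y → (x +ᶠ y) ≈ᶠ (x' +ᶠ y)
+ᶠ-congʳ e y = +ᶠ-cong e (≈ᶠ-refl {y})

den-^-nonZero : ∀ x → .(NonZeroₚ (den x)) → ∀ k → NonZeroₚ (den (x ^ k))
den-^-nonZero x x≠0 zero    = one≠0
den-^-nonZero x x≠0 (suc k) = *ₚ-nonZero (den-^-nonZero x x≠0 k) x≠0

den-poch-nonZero : ∀ x y → .(NonZeroₚ (den x)) → .(NonZeroₚ (den y)) → ∀ k → NonZeroₚ (den (poch x y k))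
den-poch-nonZero x y x≠0 y≠0 zero    = one≠0
den-poch-nonZero x y x≠0 y≠0 (suc k) =
  *ₚ-nonZero (den-poch-nonZero x y x≠0 y≠0 k) (*ₚ-nonZero one≠0 (*ₚ-nonZero x≠0 (den-^-nonZero y y≠0 k)))

den-sumTo-nonZero : ∀ (f : ℕ → RatF) n → NonZeroₚ (den (sumTo n (λ k → frac (f k))))
den-sumTo-nonZero f zero    = one≠0
den-sumTo-nonZero f (suc n) = *ₚ-nonZero (den-sumTo-nonZero f n) (den-nonZero (f n))

_^ᶠ_ : RatF → ℕ → RatF
x ^ᶠ k = frac x ^ k , den-^-nonZero (frac x) (den-nonZero x) k

pochᶠ : RatF → RatF → ℕ → RatF
pochᶠ x y k = poch (frac x) (frac y) k , den-poch-nonZero (frac x) (frac y) (den-nonZero x) (den-nonZero y) k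

sumᶠ : ℕ → (ℕ → RatF) → RatF
sumᶠ n f = sumTo n (λ k → frac (f k)) , den-sumTo-nonZero f n

open RatSolver using (solve; _:=_; _:+_; _:*_; :-_; _:-_; con; Polynomial)

^ᶠ-cong : ∀ {x y} → x ≈ᶠ y → ∀ k → (x ^ᶠ k) ≈ᶠ (y ^ᶠ k)
^ᶠ-cong e zero    = ≈ᶠ-refl
^ᶠ-cong e (suc k) = *ᶠ-cong (^ᶠ-cong e k) e

^ᶠ-*-distrib : ∀ x y k → ((x *ᶠ y) ^ᶠ k) ≈ᶠ (x ^ᶠ k *ᶠ y ^ᶠ k)
^ᶠ-*-distrib x y zero    = solve 0 (con (+ 1) := con (+ 1) :* con (+ 1)) ≈ᶠ-refl
^ᶠ-*-distrib x y (suc k) = begin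
  (x *ᶠ y) ^ᶠ k *ᶠ (x *ᶠ y)          ≈⟨ *ᶠ-congʳ (^ᶠ-*-distrib x y k) (x *ᶠ y) ⟩
  (x ^ᶠ k *ᶠ y ^ᶠ k) *ᶠ (x *ᶠ y)     ≈⟨ solve 4 (λ xk yk x y → (xk :* yk) :* (x :* y) := (xk :* x) :* (yk :* y))
                                          ≈ᶠ-refl (x ^ᶠ k) (y ^ᶠ k) x y ⟩
  (x ^ᶠ k *ᶠ x) *ᶠ (y ^ᶠ k *ᶠ y)     ∎

^ᶠ-square : ∀ x k → ((x ^ᶠ 2) ^ᶠ k) ≈ᶠ (x ^ᶠ k *ᶠ x ^ᶠ k)
^ᶠ-square x k = ≈ᶠ-trans
  (^ᶠ-cong (solve 1 (λ x → (con (+ 1) :* x) :* x := x :* x) ≈ᶠ-refl x) k)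
  (^ᶠ-*-distrib x x k)

pochᶠ-cong : ∀ {x x'} → x ≈ᶠ x' → ∀ y k → pochᶠ x y k ≈ᶠ pochᶠ x' y k
pochᶠ-cong e y zero    = ≈ᶠ-refl
pochᶠ-cong e y (suc k) =
  *ᶠ-cong (pochᶠ-cong e y k) (+ᶠ-congˡ 1ᶠ (-ᶠ-cong (*ᶠ-congʳ e (y ^ᶠ k))))

pochᶠ-shift : ∀ x y k → pochᶠ x y (suc k) ≈ᶠ ((1ᶠ -ᶠ x) *ᶠ pochᶠ (x *ᶠ y) y k)
pochᶠ-shift x y zero    = solve 1 (λ x → con (+ 1) :* (con (+ 1) :- x :* con (+ 1)) := (con (+ 1) :- x) :* con (+ 1))
                            ≈ᶠ-refl x
pochᶠ-shift x y (suc k) = begin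
  pochᶠ x y (suc k) *ᶠ (1ᶠ -ᶠ x *ᶠ (y ^ᶠ k *ᶠ y))
    ≈⟨ *ᶠ-congʳ (pochᶠ-shift x y k) (1ᶠ -ᶠ x *ᶠ (y ^ᶠ k *ᶠ y)) ⟩
  ((1ᶠ -ᶠ x) *ᶠ pochᶠ (x *ᶠ y) y k) *ᶠ (1ᶠ -ᶠ x *ᶠ (y ^ᶠ k *ᶠ y))
    ≈⟨ solve 4 (λ x y yk p → ((con (+ 1) :- x) :* p) :* (con (+ 1) :- x :* (yk :* y))
                           := (con (+ 1) :- x) :* (p :* (con (+ 1) :- (x :* y) :* yk)))
         ≈ᶠ-refl x y (y ^ᶠ k) (pochᶠ (x *ᶠ y) y k) ⟩
  (1ᶠ -ᶠ x) *ᶠ pochᶠ (x *ᶠ y) y (suc k) ∎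

sumᶠ-+ : ∀ (f g : ℕ → RatF) n → sumᶠ n (λ k → f k +ᶠ g k) ≈ᶠ (sumᶠ n f +ᶠ sumᶠ n g)
sumᶠ-+ f g zero    = ≈ᶠ-sym (+ᶠ-identityˡ 0ᶠ)
sumᶠ-+ f g (suc n) = begin
  sumᶠ n (λ k → f k +ᶠ g k) +ᶠ (f n +ᶠ g n)  ≈⟨ +ᶠ-congʳ (sumᶠ-+ f g n) (f n +ᶠ g n) ⟩
  (sumᶠ n f +ᶠ sumᶠ n g) +ᶠ (f n +ᶠ g n)     ≈⟨ solve 4 (λ s t a b → (s :+ t) :+ (a :+ b) := (s :+ a) :+ (t :+ b))
                                                  ≈ᶠ-refl (sumᶠ n f) (sumᶠ n g) (f n) (g n) ⟩
  (sumᶠ n f +ᶠ f n) +ᶠ (sumᶠ n g +ᶠ g n)     ∎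

sumᶠ-*ˡ : ∀ c (f : ℕ → RatF) n → sumᶠ n (λ k → c *ᶠ f k) ≈ᶠ (c *ᶠ sumᶠ n f)
sumᶠ-*ˡ c f zero    = ≈ᶠ-sym (≈ᶠ-trans (*ᶠ-comm c 0ᶠ) (mkᶠ ≋-refl))
sumᶠ-*ˡ c f (suc n) = begin
  sumᶠ n (λ k → c *ᶠ f k) +ᶠ c *ᶠ f n  ≈⟨ +ᶠ-congʳ (sumᶠ-*ˡ c f n) (c *ᶠ f n) ⟩
  c *ᶠ sumᶠ n f +ᶠ c *ᶠ f n            ≈⟨ solve 3 (λ c s a → c :* s :+ c :* a := c :* (s :+ a))
                                            ≈ᶠ-refl c (sumᶠ n f) (f n) ⟩
  c *ᶠ (sumᶠ n f +ᶠ f n)               ∎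

telescope : ∀ (t c : ℕ → RatF) → t 0 ≈ᶠ c 0 → (∀ m → t (suc m) ≈ᶠ (c (suc m) -ᶠ c m)) →
            ∀ m → sumᶠ (suc m) t ≈ᶠ c m
telescope t c t₀ tₛ zero    = ≈ᶠ-trans (+ᶠ-identityˡ (t 0)) t₀
telescope t c t₀ tₛ (suc m) = begin
  sumᶠ (suc m) t +ᶠ t (suc m)      ≈⟨ +ᶠ-cong (telescope t c t₀ tₛ m) (tₛ m) ⟩
  c m +ᶠ (c (suc m) -ᶠ c m)        ≈⟨ solve 2 (λ a b → a :+ (b :- a) := b) ≈ᶠ-refl (c m) (c (suc m)) ⟩
  c (suc m)                        ∎

-- Nonvanishing numerators, detected by the constant coefficient.

c₀ : Poly → ℤ
c₀ p = coeff p 0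

c₀-* : ∀ p r → c₀ (p *ₚ r) ≡ c₀ p *ℤ c₀ r
c₀-* []       r = sym (ℤ.*-zeroˡ (c₀ r))
c₀-* (x ∷ xs) r = trans (coeff-∷* x xs r 0) (ℤ.+-identityʳ _)

c₀-nonZero : ∀ {p} → c₀ p ≡ + 1 → NonZeroₚ p
c₀-nonZero c₀≡1 p≡0 with trans (sym c₀≡1) (get p≡0 0)
... | ()

c₀-num-1- : ∀ x → c₀ (num (1f - x)) ≡ c₀ (den x) +ℤ - c₀ (num x)
c₀-num-1- (a / b) =
  trans (coeff-+ ((+ 1 ∷ []) *ₚ b) (negₚ a *ₚ (+ 1 ∷ [])) 0)
  (cong₂ _+ℤ_ (trans (c₀-* (+ 1 ∷ []) b) (ℤ.*-identityˡ (c₀ b)))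
              (trans (c₀-* (negₚ a) (+ 1 ∷ [])) (trans (ℤ.*-identityʳ _) (coeff-neg a 0))))

num-1-nonZero : ∀ x → c₀ (num x) ≡ + 0 → c₀ (den x) ≡ + 1 → NonZeroₚ (num (1f - x))
num-1-nonZero x num₀ den₀ = c₀-nonZero (trans (c₀-num-1- x) (cong₂ (λ a b → a +ℤ - b) den₀ num₀))

qᶠ : RatF
qᶠ = q , one≠0

num-q-nonZero : NonZeroₚ (num q)
num-q-nonZero e = one≠0 (mk λ i → get e (suc i))

q⁻¹ᶠ : RatF
q⁻¹ᶠ = recipᶠ qᶠ num-q-nonZero

q⁻¹ᶠ-inverse : (q⁻¹ᶠ *ᶠ qᶠ) ≈ᶠ 1ᶠ
q⁻¹ᶠ-inverse = recipᶠ-inverseˡ qᶠ num-q-nonZero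

c₀-den-qᵏ : ∀ k → c₀ (den (q ^ k)) ≡ + 1
c₀-den-qᵏ zero    = refl
c₀-den-qᵏ (suc k) = trans (c₀-* (den (q ^ k)) (+ 1 ∷ [])) (cong (_*ℤ + 1) (c₀-den-qᵏ k))

num-1-qᵏ⁺¹-nonZero : ∀ k → NonZeroₚ (num (1f - q * q ^ k))
num-1-qᵏ⁺¹-nonZero k = num-1-nonZero (q * q ^ k)
  (trans (c₀-* (num q) (num (q ^ k))) (ℤ.*-zeroˡ (c₀ (num (q ^ k)))))
  (trans (c₀-* (+ 1 ∷ []) (den (q ^ k))) (trans (ℤ.*-identityˡ _) (c₀-den-qᵏ k)))

num-qPoch-nonZero : ∀ k → NonZeroₚ (num (poch q q k))
num-qPoch-nonZero zero    = one≠0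
num-qPoch-nonZero (suc k) = *ₚ-nonZero (num-qPoch-nonZero k) (num-1-qᵏ⁺¹-nonZero k)

num-1-q-nonZero : NonZeroₚ (num (1f - q))
num-1-q-nonZero = num-1-nonZero q refl refl

ν : RatF
ν = recipᶠ (1ᶠ -ᶠ qᶠ) num-1-q-nonZero

ν-inverse : (ν *ᶠ (1ᶠ -ᶠ qᶠ)) ≈ᶠ 1ᶠ
ν-inverse = recipᶠ-inverseˡ (1ᶠ -ᶠ qᶠ) num-1-q-nonZero

ρ : ℕ → RatF
ρ k = recipᶠ (1ᶠ -ᶠ qᶠ *ᶠ qᶠ ^ᶠ k) (num-1-qᵏ⁺¹-nonZero k)

α β : ℕ → RatF
α k = pochᶠ qᶠ (qᶠ ^ᶠ 2) k *ᶠ recipᶠ (pochᶠ qᶠ qᶠ k) (num-qPoch-nonZero k)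
β k = pochᶠ q⁻¹ᶠ (qᶠ ^ᶠ 2) k *ᶠ recipᶠ (pochᶠ qᶠ qᶠ k) (num-qPoch-nonZero k)

-- (q⁻¹;q²)ₖ₊₁ = (1-q⁻¹)(q;q²)ₖ, since q⁻¹·q² = q.
qPoch-q⁻¹-shift : ∀ k → pochᶠ q⁻¹ᶠ (qᶠ ^ᶠ 2) (suc k) ≈ᶠ ((1ᶠ -ᶠ q⁻¹ᶠ) *ᶠ pochᶠ qᶠ (qᶠ ^ᶠ 2) k)
qPoch-q⁻¹-shift k = ≈ᶠ-trans (pochᶠ-shift q⁻¹ᶠ (qᶠ ^ᶠ 2) k)
  (*ᶠ-congˡ (1ᶠ -ᶠ q⁻¹ᶠ) (pochᶠ-cong q⁻¹q²≈q (qᶠ ^ᶠ 2) k))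
  where
  q⁻¹q²≈q : (q⁻¹ᶠ *ᶠ qᶠ ^ᶠ 2) ≈ᶠ qᶠ
  q⁻¹q²≈q = begin
    q⁻¹ᶠ *ᶠ ((1ᶠ *ᶠ qᶠ) *ᶠ qᶠ)  ≈⟨ solve 2 (λ u x → u :* ((con (+ 1) :* x) :* x) := (u :* x) :* x) ≈ᶠ-refl q⁻¹ᶠ qᶠ ⟩
    (q⁻¹ᶠ *ᶠ qᶠ) *ᶠ qᶠ          ≈⟨ *ᶠ-congʳ q⁻¹ᶠ-inverse qᶠ ⟩
    1ᶠ *ᶠ qᶠ                    ≈⟨ *ᶠ-identityˡ qᶠ ⟩
    qᶠ                          ∎

β-step : ∀ k → (ν *ᶠ (β (suc k) *ᶠ qᶠ)) ≈ᶠ (-ᶠ (α k *ᶠ ρ k))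
β-step k = begin
  -- 1/(q;q)ₖ₊₁ unfolds to (1/(q;q)ₖ)·ρₖ by computation.
  ν *ᶠ ((pochᶠ q⁻¹ᶠ q² (suc k) *ᶠ (r *ᶠ ρ k)) *ᶠ qᶠ)
    ≈⟨ *ᶠ-congˡ ν (*ᶠ-congʳ (*ᶠ-congʳ (qPoch-q⁻¹-shift k) (r *ᶠ ρ k)) qᶠ) ⟩
  ν *ᶠ ((((1ᶠ -ᶠ q⁻¹ᶠ) *ᶠ p) *ᶠ (r *ᶠ ρ k)) *ᶠ qᶠ)
    ≈⟨ solve 6 (λ v u p r s x → v :* ((((con (+ 1) :- u) :* p) :* (r :* s)) :* x)
                              := (v :* (x :- u :* x)) :* ((p :* r) :* s))
         ≈ᶠ-refl ν q⁻¹ᶠ p r (ρ k) qᶠ ⟩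
  (ν *ᶠ (qᶠ -ᶠ q⁻¹ᶠ *ᶠ qᶠ)) *ᶠ (α k *ᶠ ρ k)
    ≈⟨ *ᶠ-congʳ (*ᶠ-congˡ ν (+ᶠ-congˡ qᶠ (-ᶠ-cong q⁻¹ᶠ-inverse))) (α k *ᶠ ρ k) ⟩
  (ν *ᶠ (qᶠ -ᶠ 1ᶠ)) *ᶠ (α k *ᶠ ρ k)
    ≈⟨ solve 3 (λ v x z → (v :* (x :- con (+ 1))) :* z := :- ((v :* (con (+ 1) :- x)) :* z))
         ≈ᶠ-refl ν qᶠ (α k *ᶠ ρ k) ⟩
  -ᶠ ((ν *ᶠ (1ᶠ -ᶠ qᶠ)) *ᶠ (α k *ᶠ ρ k))
    ≈⟨ -ᶠ-cong (*ᶠ-congʳ ν-inverse (α k *ᶠ ρ k)) ⟩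
  -ᶠ (1ᶠ *ᶠ (α k *ᶠ ρ k))
    ≈⟨ -ᶠ-cong (*ᶠ-identityˡ (α k *ᶠ ρ k)) ⟩
  -ᶠ (α k *ᶠ ρ k) ∎
  where
  q² = qᶠ ^ᶠ 2
  p  = pochᶠ qᶠ q² k
  r  = recipᶠ (pochᶠ qᶠ qᶠ k) (num-qPoch-nonZero k)

one : ∀ {n} → Polynomial n
one = con (+ 1)

ρ-inverse : ∀ k → (ρ k *ᶠ (1ᶠ -ᶠ qᶠ *ᶠ qᶠ ^ᶠ k)) ≈ᶠ 1ᶠ
ρ-inverse k = recipᶠ-inverseˡ (1ᶠ -ᶠ qᶠ *ᶠ qᶠ ^ᶠ k) (num-1-qᵏ⁺¹-nonZero k)

ρ-cancel : ∀ z k → ((z *ᶠ ρ k) *ᶠ (1ᶠ -ᶠ qᶠ *ᶠ qᶠ ^ᶠ k)) ≈ᶠ z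
ρ-cancel z k = begin
  (z *ᶠ ρ k) *ᶠ (1ᶠ -ᶠ qᶠ *ᶠ qᶠ ^ᶠ k)  ≈⟨ *ᶠ-assoc z (ρ k) (1ᶠ -ᶠ qᶠ *ᶠ qᶠ ^ᶠ k) ⟩
  z *ᶠ (ρ k *ᶠ (1ᶠ -ᶠ qᶠ *ᶠ qᶠ ^ᶠ k))  ≈⟨ *ᶠ-congˡ z (ρ-inverse k) ⟩
  z *ᶠ 1ᶠ                             ≈⟨ solve 1 (λ z → z :* one := z) ≈ᶠ-refl z ⟩
  z                                   ∎

α-step : ∀ k → α (suc k) ≈ᶠ ((α k *ᶠ ρ k) *ᶠ (1ᶠ -ᶠ qᶠ *ᶠ (qᶠ ^ᶠ k *ᶠ qᶠ ^ᶠ k)))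
α-step k = begin
  (p *ᶠ (1ᶠ -ᶠ qᶠ *ᶠ (qᶠ ^ᶠ 2) ^ᶠ k)) *ᶠ (r *ᶠ ρ k)
    ≈⟨ *ᶠ-congʳ (*ᶠ-congˡ p (+ᶠ-congˡ 1ᶠ (-ᶠ-cong (*ᶠ-congˡ qᶠ (^ᶠ-square qᶠ k))))) (r *ᶠ ρ k) ⟩
  (p *ᶠ (1ᶠ -ᶠ qᶠ *ᶠ (qᶠ ^ᶠ k *ᶠ qᶠ ^ᶠ k))) *ᶠ (r *ᶠ ρ k)
    ≈⟨ solve 4 (λ p r s y → (p :* y) :* (r :* s) := ((p :* r) :* s) :* y)
         ≈ᶠ-refl p r (ρ k) (1ᶠ -ᶠ qᶠ *ᶠ (qᶠ ^ᶠ k *ᶠ qᶠ ^ᶠ k)) ⟩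
  (α k *ᶠ ρ k) *ᶠ (1ᶠ -ᶠ qᶠ *ᶠ (qᶠ ^ᶠ k *ᶠ qᶠ ^ᶠ k)) ∎
  where
  p = pochᶠ qᶠ (qᶠ ^ᶠ 2) k
  r = recipᶠ (pochᶠ qᶠ qᶠ k) (num-qPoch-nonZero k)

f₁ g₁ g₂ : ℕ → RatF
f₁ k = α k *ᶠ qᶠ ^ᶠ k
g₁ k = (β k *ᶠ qᶠ ^ᶠ k) *ᶠ (1ᶠ -ᶠ qᶠ ^ᶠ k)
g₂ k = (β k *ᶠ qᶠ ^ᶠ k) *ᶠ (qᶠ -ᶠ qᶠ ^ᶠ k)

-- Each term of the second sum of the first identity cancels the previous
-- term of the first sum: ν·g₁(k+1) = -f₁(k).
g₁-step : ∀ k → (ν *ᶠ g₁ (suc k)) ≈ᶠ (-ᶠ f₁ k)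
g₁-step k = begin
  ν *ᶠ ((β (suc k) *ᶠ (x *ᶠ qᶠ)) *ᶠ (1ᶠ -ᶠ x *ᶠ qᶠ))
    ≈⟨ solve 4 (λ v b x y → v :* ((b :* (x :* y)) :* (one :- x :* y)) := (v :* (b :* y)) :* (x :* (one :- y :* x)))
         ≈ᶠ-refl ν (β (suc k)) x qᶠ ⟩
  (ν *ᶠ (β (suc k) *ᶠ qᶠ)) *ᶠ (x *ᶠ (1ᶠ -ᶠ qᶠ *ᶠ x))
    ≈⟨ *ᶠ-congʳ (β-step k) (x *ᶠ (1ᶠ -ᶠ qᶠ *ᶠ x)) ⟩
  (-ᶠ (α k *ᶠ ρ k)) *ᶠ (x *ᶠ (1ᶠ -ᶠ qᶠ *ᶠ x))
    ≈⟨ solve 4 (λ a s x y → (:- (a :* s)) :* (x :* (one :- y :* x)) := :- (((a :* x) :* s) :* (one :- y :* x)))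
         ≈ᶠ-refl (α k) (ρ k) x qᶠ ⟩
  -ᶠ ((f₁ k *ᶠ ρ k) *ᶠ (1ᶠ -ᶠ qᶠ *ᶠ x))
    ≈⟨ -ᶠ-cong (ρ-cancel (f₁ k) k) ⟩
  -ᶠ f₁ k ∎
  where
  x = qᶠ ^ᶠ k

-- The terms of the second identity are differences of consecutive α's:
-- ν·g₂(k+1) = αₖ - αₖ₊₁.
g₂-step : ∀ k → (ν *ᶠ g₂ (suc k)) ≈ᶠ (α k -ᶠ α (suc k))
g₂-step k = begin
  ν *ᶠ ((β (suc k) *ᶠ (x *ᶠ qᶠ)) *ᶠ (qᶠ -ᶠ x *ᶠ qᶠ))
    ≈⟨ solve 4 (λ v b x y → v :* ((b :* (x :* y)) :* (y :- x :* y)) := (v :* (b :* y)) :* (x :* (y :- x :* y)))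
         ≈ᶠ-refl ν (β (suc k)) x qᶠ ⟩
  (ν *ᶠ (β (suc k) *ᶠ qᶠ)) *ᶠ (x *ᶠ (qᶠ -ᶠ x *ᶠ qᶠ))
    ≈⟨ *ᶠ-congʳ (β-step k) (x *ᶠ (qᶠ -ᶠ x *ᶠ qᶠ)) ⟩
  (-ᶠ (α k *ᶠ ρ k)) *ᶠ (x *ᶠ (qᶠ -ᶠ x *ᶠ qᶠ))
    ≈⟨ solve 3 (λ z x y → (:- z) :* (x :* (y :- x :* y)) := z :* (one :- y :* x) :- z :* (one :- y :* (x :* x)))
         ≈ᶠ-refl (α k *ᶠ ρ k) x qᶠ ⟩
  (α k *ᶠ ρ k) *ᶠ (1ᶠ -ᶠ qᶠ *ᶠ x) -ᶠ (α k *ᶠ ρ k) *ᶠ (1ᶠ -ᶠ qᶠ *ᶠ (x *ᶠ x))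
    ≈⟨ +ᶠ-cong (ρ-cancel (α k) k) (-ᶠ-cong (≈ᶠ-sym (α-step k))) ⟩
  α k -ᶠ α (suc k) ∎
  where
  x = qᶠ ^ᶠ k

first-identity : ∀ m → (sumᶠ (suc m) f₁ +ᶠ ν *ᶠ sumᶠ (suc m) g₁) ≈ᶠ f₁ m
first-identity m = begin
  sumᶠ (suc m) f₁ +ᶠ ν *ᶠ sumᶠ (suc m) g₁       ≈⟨ +ᶠ-congˡ (sumᶠ (suc m) f₁) (≈ᶠ-sym (sumᶠ-*ˡ ν g₁ (suc m))) ⟩
  sumᶠ (suc m) f₁ +ᶠ sumᶠ (suc m) (λ k → ν *ᶠ g₁ k) ≈⟨ ≈ᶠ-sym (sumᶠ-+ f₁ (λ k → ν *ᶠ g₁ k) (suc m)) ⟩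
  sumᶠ (suc m) (λ k → f₁ k +ᶠ ν *ᶠ g₁ k)        ≈⟨ telescope (λ k → f₁ k +ᶠ ν *ᶠ g₁ k) f₁ first-term
                                                     (λ k → +ᶠ-congˡ (f₁ (suc k)) (g₁-step k)) m ⟩
  f₁ m                                          ∎
  where
  -- g₁(0) = 0 because of the factor 1 - q⁰.
  first-term : (f₁ 0 +ᶠ ν *ᶠ g₁ 0) ≈ᶠ f₁ 0
  first-term = solve 3 (λ a v b → a :+ v :* ((b :* one) :* (one :- one)) := a) ≈ᶠ-refl (f₁ 0) ν (β 0)

second-identity : ∀ m → (ν *ᶠ sumᶠ (suc m) g₂) ≈ᶠ (-ᶠ α m)
second-identity m = begin
  ν *ᶠ sumᶠ (suc m) g₂                ≈⟨ ≈ᶠ-sym (sumᶠ-*ˡ ν g₂ (suc m)) ⟩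
  sumᶠ (suc m) (λ k → ν *ᶠ g₂ k)      ≈⟨ telescope (λ k → ν *ᶠ g₂ k) (λ k → -ᶠ α k) first-term
                                           (λ k → ≈ᶠ-trans (g₂-step k) (difference (α k) (α (suc k)))) m ⟩
  -ᶠ α m                              ∎
  where
  -- ν·g₂(0) = ν·(q - 1) = -1 = -α₀, as β₀ = α₀ = 1.
  first-term : (ν *ᶠ g₂ 0) ≈ᶠ (-ᶠ α 0)
  first-term = begin
    ν *ᶠ ((α 0 *ᶠ 1ᶠ) *ᶠ (qᶠ -ᶠ 1ᶠ))  ≈⟨ solve 3 (λ v a y → v :* ((a :* one) :* (y :- one)) := :- ((v :* (one :- y)) :* a))
                                           ≈ᶠ-refl ν (α 0) qᶠ ⟩
    -ᶠ ((ν *ᶠ (1ᶠ -ᶠ qᶠ)) *ᶠ α 0)      ≈⟨ -ᶠ-cong (*ᶠ-congʳ ν-inverse (α 0)) ⟩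
    -ᶠ (1ᶠ *ᶠ α 0)                    ≈⟨ -ᶠ-cong (*ᶠ-identityˡ (α 0)) ⟩
    -ᶠ α 0                            ∎
  difference : ∀ a b → (a -ᶠ b) ≈ᶠ ((-ᶠ b) -ᶠ (-ᶠ a))
  difference = solve 2 (λ a b → a :- b := (:- b) :- (:- a)) ≈ᶠ-refl

lemma2p1 : (n : ℕ) → 1 ≤ n →
    ((sumTo n (λ k → (poch q (q ^ 2) k ÷ poch q q k) * q ^ k)
       + recip (1f - q) * sumTo n (λ k → (poch q⁻¹ (q ^ 2) k ÷ poch q q k) * q ^ k * (1f - q ^ k)))
      ≈ (poch q (q ^ 2) (n ∸ 1) ÷ poch q q (n ∸ 1)) * q ^ (n ∸ 1))
    ×
    ((recip (1f - q) * sumTo n (λ k → (poch q⁻¹ (q ^ 2) k ÷ poch q q k) * q ^ k * (q - q ^ k)))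
      ≈ neg (poch q (q ^ 2) (n ∸ 1) ÷ poch q q (n ∸ 1)))
lemma2p1 (suc m) _ = ≈ᶠ⇒≈ (first-identity m) ,, ≈ᶠ⇒≈ (second-identity m)
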